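{- Let $\mathcal{A}$ be an algebra with two multiplications $\cdot,\ast$ and cumulants $\kappa$ as in the context. Let $A_1,\dots,A_n$ be finite multisets of elements of $\mathcal{A}$ and $A=A_1\cup\cdots\cup A_n$. Then $$\sum_{\nu\in\mathcal{P}_{\mathrm{mix}}(A)}\kappa_\nu=-\sum_{\omega\in\mathcal{S}(A)}(-1)^{|\omega|}\kappa_\omega .$$
   Context: $\mathcal{A}$ is a vector space over a field with two bilinear products $\cdot,\ast$ making $(\mathcal{A},\cdot)$ and $(\mathcal{A},\ast)$ commutative associative unital algebras. The cumulants $\kappa:\mathcal{A}^m\to\mathcal{A}$ are the symmetric multilinear maps determined by $a_1\ast\cdots\ast a_m=\sum_{\nu}\prod_{b\in\nu}\kappa(a_i:i\in b)$ (sum over set partitions of $\{1,\dots,m\}$, $\cdot$-product over blocks); $\kappa(a)=a$. Elements of $A$ are regarded as distinguishable, each belonging to a specified $A_i$. For a partition $\nu$ of $A$, $\kappa_\nu=\prod_{b\in\nu}\kappa(a:a\in b)$ ($\cdot$-product). A partition $\nu=\{\nu_1,\dots,\nu_l\}$ of $A$ is mixing if some block $\nu_i$ is not contained in any single $A_j$; $\mathcal{P}_{\mathrm{mix}}(A)$ is the set of mixing partitions. A nested upward sequence of partitions is $\omega=(\nu^1\nearrow\cdots\nearrow\nu^r)$, $r\ge1$, where $\nu^1$ is a partition of $A$, each $\nu^{i+1}$ is a partition of the set $\nu^i$ (whose elements are the blocks of $\nu^i$), and each $\nu^{i+1}$ is not the partition of $\nu^i$ into singletons; $|\omega|:=r$.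 $\mathcal{S}(A)$ is the set of such $\omega$ with $\nu^1$ mixing. The cumulant $\kappa_\omega$ is computed as follows: start with the family of elements of $A$; for $i=1,\dots,r$, replace the current family by the family indexed by the blocks of $\nu^i$, whose entry for a block is $\kappa$ applied to the entries indexed by the elements of that block; finally $\kappa_\omega$ is the $\ast$-product of all entries of the family obtained after step $r$. (E.g. for $A=\{a_1,\dots,a_5\}$, $\nu^1=\{\{a_1,a_4\},\{a_2\},\{a_3\},\{a_5\}\}$, $\nu^2=\{\{\{a_1,a_4\},\{a_2\},\{a_3\}\},\{\{a_5\}\}\}$, one gets $\kappa_\omega=\kappa(\kappa(a_1,a_4),a_2,a_3)\ast a_5$.) -}

module Defs where

open import Level using (Level; _⊔_; suc)
open import Algebra.Bundles using (CommutativeRing)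
open import Algebra.Module.Bundles using (Module)
open import Data.Bool using (Bool; true; false; not)
open import Data.Fin using (Fin)
open import Data.Fin.Properties using (_≟_)
open import Data.Nat using (ℕ; zero) renaming (suc to 1+_; _≡ᵇ_ to _==_)
open import Data.List using (List; []; _∷_; [_]; map; concatMap; foldr; filter; length; allFin)
open import Data.Bool using (_∧_; _∨_)
open import Relation.Nullary.Decidable using (T?)
open import Data.Product using (_×_; _,_; proj₁; proj₂; ∃)
open import Relation.Nullary using (¬_; does)

record Field (c ℓ : Level) : Set (suc (c ⊔ ℓ)) where
  field
    commutativeRing : CommutativeRing c ℓ
  open CommutativeRing commutativeRing public
  field
    1≉0     : ¬ (1# ≈ 0#)
    inverse : ∀ x → ¬ (x ≈ 0#) → ∃ λ y → (x * y) ≈ 1#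

record TwoProductAlgebra {k ℓk : Level} (K : Field k ℓk) (a ℓa : Level)
       : Set (k ⊔ ℓk ⊔ suc (a ⊔ ℓa)) where
  open Field K using (commutativeRing) renaming (Carrier to Scalar)
  field
    vectorSpace : Module commutativeRing a ℓa
  open Module vectorSpace public
  field
    _·_     : Carrierᴹ → Carrierᴹ → Carrierᴹ
    1·      : Carrierᴹ
    ·-cong  : ∀ {x x′ y y′} → x ≈ᴹ x′ → y ≈ᴹ y′ → (x · y) ≈ᴹ (x′ · y′)
    ·-assoc : ∀ x y z → ((x · y) · z) ≈ᴹ (x · (y · z))
    ·-comm  : ∀ x y → (x · y) ≈ᴹ (y · x)
    ·-identityˡ : ∀ x → (1· · x) ≈ᴹ x
    ·-distribʳ-+ : ∀ x y z → ((x +ᴹ y) · z) ≈ᴹ ((x · z) +ᴹ (y · z))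
    ·-scalarˡ : ∀ (λ′ : Scalar) x y → ((λ′ *ₗ x) · y) ≈ᴹ (λ′ *ₗ (x · y))
    _∗_     : Carrierᴹ → Carrierᴹ → Carrierᴹ
    1∗      : Carrierᴹ
    ∗-cong  : ∀ {x x′ y y′} → x ≈ᴹ x′ → y ≈ᴹ y′ → (x ∗ y) ≈ᴹ (x′ ∗ y′)
    ∗-assoc : ∀ x y z → ((x ∗ y) ∗ z) ≈ᴹ (x ∗ (y ∗ z))
    ∗-comm  : ∀ x y → (x ∗ y) ≈ᴹ (y ∗ x)
    ∗-identityˡ : ∀ x → (1∗ ∗ x) ≈ᴹ x
    ∗-distribʳ-+ : ∀ x y z → ((x +ᴹ y) ∗ z) ≈ᴹ ((x ∗ z) +ᴹ (y ∗ z))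
    ∗-scalarˡ : ∀ (λ′ : Scalar) x y → ((λ′ *ₗ x) ∗ y) ≈ᴹ (λ′ *ₗ (x ∗ y))

-- Set partitions of a list, elements regarded as distinguishable by
-- position.  A partition is a list of (nonempty) blocks; every set
-- partition of the positions occurs exactly once in 'parts xs'.

module _ {a} {X : Set a} where

  insertEach : X → List (List X) → List (List (List X))
  insertEach x []       = []
  insertEach x (b ∷ bs) = ((x ∷ b) ∷ bs) ∷ map (b ∷_) (insertEach x bs)

  parts : List X → List (List (List X))
  parts []       = [] ∷ []
  parts (x ∷ xs) = concatMap (λ p → ([ x ] ∷ p) ∷ insertEach x p) (parts xs)

  allSingletons : List (List X) → Bool
  allSingletons π = foldr (λ b r → (length b == 1) ∧ r) true π

  nontrivialParts : List X → List (List (List X))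
  nontrivialParts xs = filter (λ π → T? (not (allSingletons π))) (parts xs)

module Cumulants {k ℓk a ℓa} {K : Field k ℓk} (𝒜 : TwoProductAlgebra K a ℓa) where
  open TwoProductAlgebra 𝒜

  Σᴹ : List Carrierᴹ → Carrierᴹ
  Σᴹ = foldr _+ᴹ_ 0ᴹ

  Π· : List Carrierᴹ → Carrierᴹ
  Π· = foldr _·_ 1·

  Π∗ : List Carrierᴹ → Carrierᴹ
  Π∗ = foldr _∗_ 1∗

  sign : ℕ → Carrierᴹ → Carrierᴹ
  sign zero   x = x
  sign (1+ r) x = -ᴹ (sign r x)

  -- κ (on finite families, given as lists) is the family of cumulants:
  -- for every m ≥ 1, a₁ ∗ ⋯ ∗ aₘ = Σ_ν Π·_{b ∈ ν} κ(aᵢ : i ∈ b).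
  -- (These relations determine κ uniquely, recursively in m.)
  IsCumulant : (List Carrierᴹ → Carrierᴹ) → Set (a ⊔ ℓa)
  IsCumulant κ = ∀ (x : Carrierᴹ) (xs : List Carrierᴹ) →
    Π∗ (x ∷ xs) ≈ᴹ Σᴹ (map (λ ν → Π· (map κ ν)) (parts (x ∷ xs)))

  module _ (κ : List Carrierᴹ → Carrierᴹ) where

    κₚ : List (List Carrierᴹ) → Carrierᴹ
    κₚ ν = Π· (map κ ν)

    -- Given the current family xs (after some steps of a nested sequence),
    -- list all ways to continue with further steps ν^{i+1} ↗ ⋯ (each a
    -- partition of the current family which is not the partition into
    -- singletons), including stopping right now.  Each continuation is
    -- recorded as (number of further steps, ∗-product of the final family).
    -- The fuel bounds the number of further steps; since every step
    -- strictly decreases the length of the family, fuel ≥ length xs is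
    -- enough to enumerate all continuations.
    continuations : ℕ → List Carrierᴹ → List (ℕ × Carrierᴹ)
    continuations zero     xs = (0 , Π∗ xs) ∷ []
    continuations (1+ f) xs = (0 , Π∗ xs) ∷
      concatMap (λ π → map (λ p → (1+ proj₁ p , proj₂ p))
                           (continuations f (map κ π)))
                (nontrivialParts xs)

    module _ {n : ℕ} where

      -- the elements of A = A₁ ∪ ⋯ ∪ Aₙ, each tagged by the index j of the Aⱼ
      -- it belongs to (elements distinguishable by position)
      union : (Fin n → List Carrierᴹ) → List (Fin n × Carrierᴹ)
      union As = concatMap (λ j → map (j ,_) (As j)) (allFin n)

      inSingle : List (Fin n × Carrierᴹ) → Bool
      inSingle []            = true
      inSingle ((j , _) ∷ b) = foldr (λ y r → does (proj₁ y ≟ j) ∧ r) true b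

      isMixing : List (List (Fin n × Carrierᴹ)) → Bool
      isMixing ν = foldr (λ b r → not (inSingle b) ∨ r) false ν

      mixingParts : (Fin n → List Carrierᴹ) → List (List (List (Fin n × Carrierᴹ)))
      mixingParts As = filter (λ ν → T? (isMixing ν)) (parts (union As))

      values : List (List (Fin n × Carrierᴹ)) → List (List Carrierᴹ)
      values ν = map (map proj₂) ν

      mixSum : (Fin n → List Carrierᴹ) → Carrierᴹ
      mixSum As = Σᴹ (map (λ ν → κₚ (values ν)) (mixingParts As))

      -- all ω = (ν¹ ↗ ⋯ ↗ νʳ) ∈ S(A), recorded as (|ω|, κ_ω)
      S : (Fin n → List Carrierᴹ) → List (ℕ × Carrierᴹ)
      S As = concatMap
        (λ ν → map (λ p → (1+ proj₁ p , proj₂ p))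
                   (continuations (length ν) (map κ (values ν))))
        (mixingParts As)

      nestSum : (Fin n → List Carrierᴹ) → Carrierᴹ
      nestSum As = Σᴹ (map (λ p → sign (proj₁ p) (proj₂ p)) (S As))

-- The proof is a Möbius-inversion argument on nested sequences.  Call a
-- "continuation" of a nonempty family ys any (possibly empty) sequence of
-- further steps ys ↗ ν ↗ ⋯ with every step a non-singleton partition, and
-- weigh it by (-1)^{#steps} times the ∗-product of the final family.  The key
-- fact (continuations-sum) is that these weights add up to Π· ys: stopping at
-- once contributes Π∗ ys, every first step π contributes -κ_π by induction,
-- and Π∗ ys - Σ_{π nontrivial} κ_π = Π· ys, because the moment–cumulant
-- relation writes Π∗ ys as the sum of κ_π over all partitions and the only
-- partition into singletons contributes Π· ys (as κ(x) = x).
-- Every ω ∈ S(A) is a first step ν ∈ P_mix(A) followed by a continuation of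
-- the family (κ(b))_{b ∈ ν}, so Σ_ω (-1)^{|ω|} κ_ω = -Σ_ν κ_ν.

module Submission where

open import Defs
open import Level using (Level)
open import Data.Nat using (ℕ)
open import Data.Fin using (Fin)
open import Data.List using (List)

open import Data.Nat using (zero; _≤_; _<_; z≤n; s≤s) renaming (suc to 1+_)
open import Data.Nat.Properties using (≤-trans; ≤-pred; m≤n⇒m≤1+n; n≤1+n)
open import Data.List using ([]; _∷_; [_]; map; concatMap; filter; length; _++_; foldr)
open import Data.List.Properties using (map-++; map-∘; length-map; filter-++; filter-none)
open import Data.List.Relation.Unary.All as All using (All; []; _∷_)
open import Data.List.Relation.Unary.All.Properties using (all-filter; filter⁺; map⁺; concat⁺)
open import Data.Bool using (Bool; true; false; not; T)
open import Data.Bool.Properties using (T-∧)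
open import Data.Product using (_×_; _,_; proj₂)
open import Function.Bundles using (Equivalence)
open import Relation.Nullary using (¬_)
open import Relation.Nullary.Decidable using (T?)
open import Relation.Binary.PropositionalEquality as ≡ using (_≡_)
open import Algebra.Bundles using (AbelianGroup)
import Algebra.Properties.AbelianGroup as AbelianGroupProperties
import Relation.Binary.Reasoning.Setoid as SetoidReasoning

data NonEmpty {a} {A : Set a} : List A → Set a where
  nonEmpty : ∀ {y ys} → NonEmpty (y ∷ ys)

NonEmpty-map : ∀ {a b} {A : Set a} {B : Set b} (f : A → B) {xs} → NonEmpty xs → NonEmpty (map f xs)
NonEmpty-map f nonEmpty = nonEmpty

All-concatMap : ∀ {a b p q} {A : Set a} {B : Set b} {P : B → Set p} {Q : A → Set q}
  (h : A → List B) → (∀ {l} → Q l → All P (h l)) → ∀ {ls} → All Q ls → All P (concatMap h ls)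
All-concatMap h f qs = concat⁺ (map⁺ (All.map f qs))

module FiniteSums {c ℓ} (G : AbelianGroup c ℓ) where
  open AbelianGroup G
  open AbelianGroupProperties G using (ε⁻¹≈ε; ⁻¹-∙-comm)
  open SetoidReasoning setoid

  Σ : List Carrier → Carrier
  Σ = foldr _∙_ ε

  Σ-++ : ∀ xs ys → Σ (xs ++ ys) ≈ Σ xs ∙ Σ ys
  Σ-++ []       ys = sym (identityˡ _)
  Σ-++ (x ∷ xs) ys = trans (∙-congˡ (Σ-++ xs ys)) (sym (assoc _ _ _))

  Σ-concatMap : ∀ {y z} {Y : Set y} {Z : Set z} (g : Z → Carrier) (h : Y → List Z) ls →
    Σ (map g (concatMap h ls)) ≈ Σ (map (λ l → Σ (map g (h l))) ls)
  Σ-concatMap g h []       = refl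
  Σ-concatMap g h (l ∷ ls) = begin
    Σ (map g (h l ++ concatMap h ls))            ≡⟨ ≡.cong Σ (map-++ g (h l) (concatMap h ls)) ⟩
    Σ (map g (h l) ++ map g (concatMap h ls))    ≈⟨ Σ-++ (map g (h l)) _ ⟩
    Σ (map g (h l)) ∙ Σ (map g (concatMap h ls)) ≈⟨ ∙-congˡ (Σ-concatMap g h ls) ⟩
    Σ (map g (h l)) ∙ Σ (map (λ l → Σ (map g (h l))) ls) ∎

  Σ-cong : ∀ {y} {Y : Set y} {g h : Y → Carrier} {ls} →
    All (λ l → g l ≈ h l) ls → Σ (map g ls) ≈ Σ (map h ls)
  Σ-cong []       = refl
  Σ-cong (e ∷ es) = ∙-cong e (Σ-cong es)

  Σ-⁻¹ : ∀ {y} {Y : Set y} (h : Y → Carrier) ls →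
    Σ (map (λ l → h l ⁻¹) ls) ≈ Σ (map h ls) ⁻¹
  Σ-⁻¹ h []       = sym ε⁻¹≈ε
  Σ-⁻¹ h (l ∷ ls) = trans (∙-congˡ (Σ-⁻¹ h ls)) (⁻¹-∙-comm _ _)

  Σ-split : ∀ {y} {Y : Set y} (b : Y → Bool) (g : Y → Carrier) ls →
    Σ (map g ls) ≈ Σ (map g (filter (λ l → T? (not (b l))) ls)) ∙ Σ (map g (filter (λ l → T? (b l)) ls))
  Σ-split b g []       = sym (identityˡ _)
  Σ-split b g (l ∷ ls) with b l
  ... | false = trans (∙-congˡ (Σ-split b g ls)) (sym (assoc _ _ _))
  ... | true  = begin
    g l ∙ Σ (map g ls)  ≈⟨ ∙-congˡ (Σ-split b g ls) ⟩
    g l ∙ (F ∙ Tr)      ≈⟨ assoc _ _ _ ⟨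
    (g l ∙ F) ∙ Tr      ≈⟨ ∙-congʳ (comm _ _) ⟩
    (F ∙ g l) ∙ Tr      ≈⟨ assoc _ _ _ ⟩
    F ∙ (g l ∙ Tr)      ∎
    where F  = Σ (map g (filter (λ l → T? (not (b l))) ls))
          Tr = Σ (map g (filter (λ l → T? (b l)) ls))

module Partitions {x} {X : Set x} where

  Trivial Nontrivial : List (List X) → Set
  Trivial    π = T (allSingletons π)
  Nontrivial π = T (not (allSingletons π))

  -- The partition of the empty family into singletons is the empty one,
  -- so a nontrivial partition has a block.
  nontrivial-nonEmpty : ∀ {π} → Nontrivial π → NonEmpty π
  nontrivial-nonEmpty {_ ∷ _} _ = nonEmpty

  extensions : X → List (List X) → List (List (List X))
  extensions y p = ([ y ] ∷ p) ∷ insertEach y p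

  -- Inserting y into a nonempty block yields a block of size ≥ 2.
  insertEach-nontrivial : ∀ (y : X) {p} → All NonEmpty p → All (λ π → ¬ Trivial π) (insertEach y p)
  insertEach-nontrivial y []                      = []
  insertEach-nontrivial y {b ∷ bs} (nonEmpty ∷ nes) =
    (λ ()) ∷ map⁺ (All.map (λ ¬t t → ¬t (proj₂ (Equivalence.to T-∧ t))) (insertEach-nontrivial y nes))

  insertEach-blocks : ∀ (y : X) {p} → All NonEmpty p → All (All NonEmpty) (insertEach y p)
  insertEach-blocks y []         = []
  insertEach-blocks y (ne ∷ nes) = (nonEmpty ∷ nes) ∷ map⁺ (All.map (ne ∷_) (insertEach-blocks y nes))

  insertEach-length : ∀ (y : X) p → All (λ π → length π ≡ length p) (insertEach y p)
  insertEach-length y []       = []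
  insertEach-length y (b ∷ bs) = ≡.refl ∷ map⁺ (All.map (≡.cong 1+_) (insertEach-length y bs))

  parts-blocks : ∀ (xs : List X) → All (All NonEmpty) (parts xs)
  parts-blocks []       = [] ∷ []
  parts-blocks (y ∷ xs) =
    All-concatMap (extensions y) (λ nes → (nonEmpty ∷ nes) ∷ insertEach-blocks y nes) (parts-blocks xs)

  trivial-extensions : ∀ (y : X) L → All (All NonEmpty) L →
    filter (λ π → T? (allSingletons π)) (concatMap (extensions y) L)
      ≡ map ([ y ] ∷_) (filter (λ π → T? (allSingletons π)) L)
  trivial-extensions y []       []         = ≡.refl
  trivial-extensions y (p ∷ L) (nes ∷ nesL)
    rewrite filter-++ (λ π → T? (allSingletons π)) (extensions y p) (concatMap (extensions y) L)
          | trivial-extensions y L nesL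
    with allSingletons p
  ... | true  = ≡.cong (λ r → ([ y ] ∷ p) ∷ r ++ _) (filter-none _ (insertEach-nontrivial y nes))
  ... | false = ≡.cong (_++ _) (filter-none _ (insertEach-nontrivial y nes))

  trivialParts : ∀ (xs : List X) → filter (λ π → T? (allSingletons π)) (parts xs) ≡ [ map [_] xs ]
  trivialParts []       = ≡.refl
  trivialParts (y ∷ xs) =
    ≡.trans (trivial-extensions y (parts xs) (parts-blocks xs)) (≡.cong (map ([ y ] ∷_)) (trivialParts xs))

  FewBlocks : List X → List (List X) → Set
  FewBlocks xs π = length π ≤ length xs × (Nontrivial π → length π < length xs)

  parts-fewBlocks : ∀ (xs : List X) → All (FewBlocks xs) (parts xs)
  parts-fewBlocks []       = (z≤n , λ ()) ∷ []
  parts-fewBlocks (y ∷ xs) = All-concatMap (extensions y) extend (parts-fewBlocks xs)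
    where
    extend : ∀ {p} → FewBlocks xs p → All (FewBlocks (y ∷ xs)) (extensions y p)
    extend {p} (le , lt) = (s≤s le , λ nt → s≤s (lt nt)) ∷
      All.map (λ eq → ≡.subst (_≤ 1+ length xs) (≡.sym eq) (m≤n⇒m≤1+n le) ,
                      λ _ → ≡.subst (_< 1+ length xs) (≡.sym eq) (s≤s le))
              (insertEach-length y p)

module CumulantSums {k ℓk a ℓa} {K : Field k ℓk} (𝒜 : TwoProductAlgebra K a ℓa) where
  open TwoProductAlgebra 𝒜
  open Cumulants 𝒜
  open FiniteSums +ᴹ-abelianGroup
  open AbelianGroupProperties +ᴹ-abelianGroup using (//-rightDividesʳ; ⁻¹-involutive)
  open SetoidReasoning ≈ᴹ-setoid
  open Partitions {X = Carrierᴹ}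
  module G = AbelianGroup +ᴹ-abelianGroup

  ·-identityʳ : ∀ x → (x · 1·) ≈ᴹ x
  ·-identityʳ x = G.trans (·-comm x 1·) (·-identityˡ x)

  ∗-identityʳ : ∀ x → (x ∗ 1∗) ≈ᴹ x
  ∗-identityʳ x = G.trans (∗-comm x 1∗) (∗-identityˡ x)

  -- Signed weight (-1)^r x of a continuation recorded as (r , x), and the
  -- same continuation preceded by one more step.
  signed : ℕ × Carrierᴹ → Carrierᴹ
  signed (r , x) = sign r x

  deeper : ℕ × Carrierᴹ → ℕ × Carrierᴹ
  deeper (r , x) = (1+ r , x)

  deeper-sum : ∀ ws → Σᴹ (map signed (map deeper ws)) ≈ᴹ -ᴹ Σᴹ (map signed ws)
  deeper-sum ws = begin
    Σᴹ (map signed (map deeper ws)) ≡⟨ ≡.cong Σᴹ (map-∘ ws) ⟨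
    Σᴹ (map (λ w → -ᴹ signed w) ws) ≈⟨ Σ-⁻¹ signed ws ⟩
    -ᴹ Σᴹ (map signed ws)           ∎

  first-step-sum : ∀ {y} {Y : Set y} (h : Y → List (ℕ × Carrierᴹ)) (t : Y → Carrierᴹ) ls →
    All (λ l → Σᴹ (map signed (h l)) ≈ᴹ t l) ls →
    Σᴹ (map signed (concatMap (λ l → map deeper (h l)) ls)) ≈ᴹ -ᴹ Σᴹ (map t ls)
  first-step-sum h t ls sums = begin
    Σᴹ (map signed (concatMap (λ l → map deeper (h l)) ls))  ≈⟨ Σ-concatMap signed _ ls ⟩
    Σᴹ (map (λ l → Σᴹ (map signed (map deeper (h l)))) ls)   ≈⟨ Σ-cong (All.map (λ {l} _ → deeper-sum (h l)) sums) ⟩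
    Σᴹ (map (λ l → -ᴹ Σᴹ (map signed (h l))) ls)             ≈⟨ Σ-⁻¹ _ ls ⟩
    -ᴹ Σᴹ (map (λ l → Σᴹ (map signed (h l))) ls)             ≈⟨ G.⁻¹-cong (Σ-cong sums) ⟩
    -ᴹ Σᴹ (map t ls)                                         ∎

  module _ (κ : List Carrierᴹ → Carrierᴹ) (isCumulant : IsCumulant κ) where

    κ-singleton : ∀ x → κ [ x ] ≈ᴹ x
    κ-singleton x = begin
      κ [ x ]                ≈⟨ ·-identityʳ _ ⟨
      κ [ x ] · 1·           ≈⟨ G.identityʳ _ ⟨
      (κ [ x ] · 1·) +ᴹ 0ᴹ   ≈⟨ isCumulant x [] ⟨
      x ∗ 1∗                 ≈⟨ ∗-identityʳ x ⟩
      x                      ∎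

    κ-singletons : ∀ ys → κₚ κ (map [_] ys) ≈ᴹ Π· ys
    κ-singletons []       = G.refl
    κ-singletons (y ∷ ys) = ·-cong (κ-singleton y) (κ-singletons ys)

    moment-decomposition : ∀ ys → NonEmpty ys →
      Π∗ ys ≈ᴹ Π· ys +ᴹ Σᴹ (map (κₚ κ) (nontrivialParts ys))
    moment-decomposition ys@(y ∷ ys′) nonEmpty = begin
      Π∗ ys                                           ≈⟨ isCumulant y ys′ ⟩
      Σᴹ (map (κₚ κ) (parts ys))                      ≈⟨ Σ-split allSingletons (κₚ κ) (parts ys) ⟩
      Σᴹ (map (κₚ κ) (nontrivialParts ys)) +ᴹ Σᴹ (map (κₚ κ) trivial)
                                                      ≈⟨ G.comm _ _ ⟩
      Σᴹ (map (κₚ κ) trivial) +ᴹ Σᴹ (map (κₚ κ) (nontrivialParts ys))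
                                                      ≈⟨ G.∙-congʳ singletons ⟩
      Π· ys +ᴹ Σᴹ (map (κₚ κ) (nontrivialParts ys))   ∎
      where
      trivial : List (List (List Carrierᴹ))
      trivial = filter (λ π → T? (allSingletons π)) (parts ys)
      singletons : Σᴹ (map (κₚ κ) trivial) ≈ᴹ Π· ys
      singletons rewrite trivialParts ys = G.trans (G.identityʳ _) (κ-singletons ys)

    continuations-sum : ∀ f ys → NonEmpty ys → length ys ≤ 1+ f →
      Σᴹ (map signed (continuations κ f ys)) ≈ᴹ Π· ys
    continuations-sum zero (y ∷ []) nonEmpty _ = begin
      (y ∗ 1∗) +ᴹ 0ᴹ ≈⟨ G.identityʳ _ ⟩
      y ∗ 1∗         ≈⟨ ∗-identityʳ y ⟩
      y              ≈⟨ ·-identityʳ y ⟨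
      y · 1·         ∎
    continuations-sum zero (_ ∷ _ ∷ _) nonEmpty (s≤s ())
    continuations-sum (1+ f) ys@(_ ∷ _) nonEmpty (s≤s enough) = begin
      Π∗ ys +ᴹ Σᴹ (map signed (concatMap (λ π → map deeper (continuations κ f (map κ π))) NT))
                                 ≈⟨ G.∙-congˡ (first-step-sum _ (κₚ κ) NT (All.map step nontrivialBounds)) ⟩
      Π∗ ys +ᴹ -ᴹ Σᴹ (map (κₚ κ) NT)
                                 ≈⟨ G.∙-congʳ (moment-decomposition ys nonEmpty) ⟩
      (Π· ys +ᴹ Σᴹ (map (κₚ κ) NT)) +ᴹ -ᴹ Σᴹ (map (κₚ κ) NT)
                                 ≈⟨ //-rightDividesʳ _ _ ⟩
      Π· ys                      ∎
      where
      NT : List (List (List Carrierᴹ))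
      NT = nontrivialParts ys
      nontrivialBounds : All (λ π → Nontrivial π × FewBlocks ys π) NT
      nontrivialBounds = All.zip (all-filter _ (parts ys) , filter⁺ _ (parts-fewBlocks ys))
      step : ∀ {π} → Nontrivial π × FewBlocks ys π →
        Σᴹ (map signed (continuations κ f (map κ π))) ≈ᴹ κₚ κ π
      step {π} (nt , _ , fewer) = continuations-sum f (map κ π) (NonEmpty-map κ (nontrivial-nonEmpty nt))
        (≡.subst (_≤ 1+ f) (≡.sym (length-map κ π)) (≤-trans (≤-pred (fewer nt)) enough))

    mixing-nonEmpty : ∀ {n} ν → T (isMixing κ {n} ν) → NonEmpty ν
    mixing-nonEmpty (_ ∷ _) _ = nonEmpty

    after-first-step : ∀ {n} ν → T (isMixing κ {n} ν) →
      Σᴹ (map signed (continuations κ (length ν) (map κ (values κ ν)))) ≈ᴹ κₚ κ (values κ ν)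
    after-first-step ν mixing = continuations-sum (length ν) _ (NonEmpty-map κ (NonEmpty-map _ (mixing-nonEmpty ν mixing)))
      (≡.subst (_≤ 1+ length ν) (≡.sym (≡.trans (length-map κ (values κ ν)) (length-map _ ν))) (n≤1+n _))

    module _ {n : ℕ} (As : Fin n → List Carrierᴹ) where

      nestSum≈-mixSum : nestSum κ As ≈ᴹ -ᴹ mixSum κ As
      nestSum≈-mixSum = first-step-sum _ (λ ν → κₚ κ (values κ ν)) (mixingParts κ As)
        (All.map (λ {ν} → after-first-step ν) (all-filter _ (parts (union κ As))))

proposition2p7 : ∀ {k ℓk a ℓa : Level} (K : Field k ℓk) (𝒜 : TwoProductAlgebra K a ℓa) →
    let open TwoProductAlgebra 𝒜 in let open Cumulants 𝒜 in
    (κ : List Carrierᴹ → Carrierᴹ) → IsCumulant κ →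
    (n : ℕ) (As : Fin n → List Carrierᴹ) →
      mixSum κ As ≈ᴹ -ᴹ (nestSum κ As)
proposition2p7 K 𝒜 κ isCumulant n As = begin
  mixSum κ As           ≈⟨ ⁻¹-involutive _ ⟨
  -ᴹ -ᴹ mixSum κ As     ≈⟨ G.⁻¹-cong (nestSum≈-mixSum κ isCumulant As) ⟨
  -ᴹ nestSum κ As       ∎
  where
  open TwoProductAlgebra 𝒜
  open Cumulants 𝒜
  open CumulantSums 𝒜
  open AbelianGroupProperties +ᴹ-abelianGroup using (⁻¹-involutive)
  open SetoidReasoning ≈ᴹ-setoid
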